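{- Fix a total order on $\bar{\mathcal{L}}$. Two perfect binary ordered trees of the same depth with labels in $\bar{\mathcal{L}}$ are equivalent if and only if their full left-regularizations are identical (as ordered labeled trees). In particular each equivalence class of ordered trees (i.e. each unordered tree, after completion) has a unique left-regularized representative.
   Context: Trees are rooted binary trees with vertex labels from $\bar{\mathcal{L}}=\mathcal{L}\cup\{N\}$ (repetitions allowed). Ordered trees have designated left/right children; $T\sim T'$ (equivalent) if $T'$ is obtained from $T$ by switching left and right subtrees at some vertices (labels move with vertices). The total order on $\bar{\mathcal{L}}$ induces the lexicographic order on strings of labels of equal length. The label string of a perfect binary ordered tree lists its labels level by level from the root downward, and within each level from left to right. Full left-regularization of a perfect binary ordered tree of depth $l$: for $k=l-1,l-2,\dots,0$ in turn, for each vertex at depth $k$, if the label string of its left subtree is lexicographically larger than that of its right subtree, switch its left and right subtrees. -}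

module Defs where

open import Data.Nat using (ℕ; zero; suc)
open import Data.List using (List; []; _∷_; _++_; concat)
open import Data.Vec using (Vec; []; _∷_; zipWith; toList)
open import Relation.Binary.Core using (Rel)
open import Relation.Binary.Structures using (IsStrictTotalOrder)
open import Relation.Binary.PropositionalEquality using (_≡_)
open import Relation.Nullary using (yes; no)
open import Data.List.Relation.Binary.Lex.Strict using (Lex-<; <-decidable)
open import Level using (Level)

data PTree {a : Level} (A : Set a) : ℕ → Set a where
  leaf : A → PTree A zero
  node : {n : ℕ} → A → PTree A n → PTree A n → PTree A (suc n)

-- Equivalence: T' is obtained from T by switching left and right
-- subtrees at some (any) set of vertices; labels move with vertices.
data _∼_ {a : Level} {A : Set a} : {n : ℕ} → PTree A n → PTree A n → Set a where
  leaf∼ : (x : A) → leaf x ∼ leaf x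
  keep  : {n : ℕ} (x : A) {l l' r r' : PTree A n} →
          l ∼ l' → r ∼ r' → node x l r ∼ node x l' r'
  swap  : {n : ℕ} (x : A) {l l' r r' : PTree A n} →
          l ∼ l' → r ∼ r' → node x l r ∼ node x r' l'

levels : {a : Level} {A : Set a} {n : ℕ} → PTree A n → Vec (List A) (suc n)
levels (leaf x)     = (x ∷ []) ∷ []
levels (node x l r) = (x ∷ []) ∷ zipWith _++_ (levels l) (levels r)

labelString : {a : Level} {A : Set a} {n : ℕ} → PTree A n → List A
labelString t = concat (toList (levels t))

module Regularize {a ℓ : Level} {A : Set a} (_<_ : Rel A ℓ)
                  (sto : IsStrictTotalOrder _≡_ _<_) where

  open IsStrictTotalOrder sto using (_≟_; _<?_)

  _<ₗ_ : Rel (List A) _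
  _<ₗ_ = Lex-< _≡_ _<_

  -- Vertices are processed from depth l-1
  -- up to depth 0; processing a vertex only depends on its subtree,
  -- whose deeper vertices have already been processed, so this is the
  -- same as: regularize both subtrees, then switch them if the label
  -- string of the left one is lexicographically larger than that of
  -- the right one.
  fullLeftReg : {n : ℕ} → PTree A n → PTree A n
  fullLeftReg (leaf x) = leaf x
  fullLeftReg (node x l r) = step (fullLeftReg l) (fullLeftReg r)
    where
    step : _ → _ → _
    step l' r' with <-decidable _≟_ _<?_ (labelString r') (labelString l')
    ... | yes _ = node x r' l'
    ... | no  _ = node x l' r'

-- Each vertex may have its children switched, so the only information an
-- equivalence class retains at a vertex is the unordered pair of the classes
-- of its subtrees.  Regularizing both subtrees first makes these classes
-- concrete trees; since trees of equal depth are determined by their label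
-- strings, ordering the two regularized subtrees lexicographically is a
-- choice that does not depend on which one came first.  Hence equivalent
-- trees have the same regularization, and as every tree is equivalent to its
-- regularization, the regularization is a canonical representative.
module Submission where

open import Defs
open import Level using (Level)
open import Data.Nat using (ℕ; suc; _+_)
open import Data.Nat.Properties using (suc-injective)
open import Data.Product using (_×_; Σ; _,_; map₁)
open import Data.List using (List; []; _∷_; _++_; length; concat)
import Data.List.Properties as List
open import Data.Vec using (Vec; []; _∷_; zipWith; toList)
import Data.Vec.Properties as Vec
open import Data.Vec.Relation.Binary.Pointwise.Inductive using (Pointwise; []; _∷_)
open import Data.List.Relation.Binary.Lex.Strict using (<-decidable; <-isStrictTotalOrder)
open import Data.List.Relation.Binary.Pointwise using (Pointwise-≡⇒≡)
open import Data.Empty using (⊥-elim)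
open import Function.Base using (_on_)
open import Relation.Binary.Core using (Rel)
open import Relation.Binary.Definitions using (tri<; tri≈; tri>)
open import Relation.Binary.Structures using (IsEquivalence; IsStrictTotalOrder)
open import Relation.Binary.PropositionalEquality
open import Relation.Nullary using (yes; no; ¬_)

module CanonicalForm {b ℓ : Level} {B : Set b} {_≈_ : Rel B ℓ}
                     (≈-isEquivalence : IsEquivalence _≈_) (f : B → B)
                     (≈-f : ∀ t → t ≈ f t)
                     (f-resp-≈ : ∀ {t u} → t ≈ u → f t ≡ f u) where

  private module ≈ = IsEquivalence ≈-isEquivalence

  ≡-reflects-≈ : ∀ {t u} → f t ≡ f u → t ≈ u
  ≡-reflects-≈ {t} {u} ft≡fu = ≈.trans (≈-f t) (subst (_≈ u) (sym ft≡fu) (≈.sym (≈-f u)))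

  f-idem : ∀ t → f (f t) ≡ f t
  f-idem t = f-resp-≈ (≈.sym (≈-f t))

  fixedPoint-unique : ∀ {t r} → t ≈ r → f r ≡ r → r ≡ f t
  fixedPoint-unique t≈r fr≡r = trans (sym fr≡r) (sym (f-resp-≈ t≈r))

module _ {a : Level} {A : Set a} where

  ∼-refl : {n : ℕ} (t : PTree A n) → t ∼ t
  ∼-refl (leaf x)     = leaf∼ x
  ∼-refl (node x l r) = keep x (∼-refl l) (∼-refl r)

  ∼-sym : {n : ℕ} {t u : PTree A n} → t ∼ u → u ∼ t
  ∼-sym (leaf∼ x)    = leaf∼ x
  ∼-sym (keep x p q) = keep x (∼-sym p) (∼-sym q)
  ∼-sym (swap x p q) = swap x (∼-sym q) (∼-sym p)

  ∼-trans : {n : ℕ} {t u v : PTree A n} → t ∼ u → u ∼ v → t ∼ v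
  ∼-trans (leaf∼ x)    (leaf∼ .x)     = leaf∼ x
  ∼-trans (keep x p q) (keep .x p' q') = keep x (∼-trans p p') (∼-trans q q')
  ∼-trans (keep x p q) (swap .x p' q') = swap x (∼-trans p p') (∼-trans q q')
  ∼-trans (swap x p q) (keep .x p' q') = swap x (∼-trans p q') (∼-trans q p')
  ∼-trans (swap x p q) (swap .x p' q') = keep x (∼-trans p q') (∼-trans q p')

  ∼-isEquivalence : {n : ℕ} → IsEquivalence (_∼_ {A = A} {n})
  ∼-isEquivalence = record { refl = ∼-refl _ ; sym = ∼-sym ; trans = ∼-trans }

  SameLengths : {m : ℕ} → Rel (Vec (List A) m) a
  SameLengths = Pointwise (_≡_ on length)

  ++-cancel-sameLength : (ws xs : List A) {ys zs : List A} → length ws ≡ length xs →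
                         ws ++ ys ≡ xs ++ zs → ws ≡ xs × ys ≡ zs
  ++-cancel-sameLength []       []       _   eq = refl , eq
  ++-cancel-sameLength (w ∷ ws) (x ∷ xs) len eq =
    map₁ (cong₂ _∷_ (List.∷-injectiveˡ eq))
         (++-cancel-sameLength ws xs (suc-injective len) (List.∷-injectiveʳ eq))

  zipWith-++-cancel : {m : ℕ} {ws xs ys zs : Vec (List A) m} → SameLengths ws xs →
                      zipWith _++_ ws ys ≡ zipWith _++_ xs zs → ws ≡ xs × ys ≡ zs
  zipWith-++-cancel {ws = []}     {[]}     {[]}     {[]}     []         _  = refl , refl
  zipWith-++-cancel {ws = w ∷ ws} {x ∷ xs} {y ∷ ys} {z ∷ zs} (len ∷ lens) eq
    with ++-cancel-sameLength w x len (Vec.∷-injectiveˡ eq)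
       | zipWith-++-cancel lens (Vec.∷-injectiveʳ eq)
  ... | refl , refl | refl , refl = refl , refl

  concat-cancel : {m : ℕ} {xss yss : Vec (List A) m} → SameLengths xss yss →
                  concat (toList xss) ≡ concat (toList yss) → xss ≡ yss
  concat-cancel {xss = []}       {[]}       []           _  = refl
  concat-cancel {xss = xs ∷ xss} {ys ∷ yss} (len ∷ lens) eq
    with ++-cancel-sameLength xs ys len eq
  ... | refl , eq' = cong (xs ∷_) (concat-cancel lens eq')

  zipWith-++-sameLengths : {m : ℕ} {ws xs ys zs : Vec (List A) m} →
                           SameLengths ws xs → SameLengths ys zs →
                           SameLengths (zipWith _++_ ws ys) (zipWith _++_ xs zs)
  zipWith-++-sameLengths []           []             = []
  zipWith-++-sameLengths {ws = w ∷ _} {x ∷ _} (len ∷ lens) (len' ∷ lens') =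
    trans (List.length-++ w) (trans (cong₂ _+_ len len') (sym (List.length-++ x)))
      ∷ zipWith-++-sameLengths lens lens'

  levels-sameLengths : {n : ℕ} (t u : PTree A n) → SameLengths (levels t) (levels u)
  levels-sameLengths (leaf _)     (leaf _)       = refl ∷ []
  levels-sameLengths (node _ l r) (node _ l' r') =
    refl ∷ zipWith-++-sameLengths (levels-sameLengths l l') (levels-sameLengths r r')

  levels-injective : {n : ℕ} (t u : PTree A n) → levels t ≡ levels u → t ≡ u
  levels-injective (leaf x) (leaf y) eq
    with List.∷-injectiveˡ (Vec.∷-injectiveˡ eq)
  ... | refl = refl
  levels-injective (node x l r) (node y l' r') eq
    with List.∷-injectiveˡ (Vec.∷-injectiveˡ eq)
       | zipWith-++-cancel (levels-sameLengths l l') (Vec.∷-injectiveʳ eq)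
  ... | refl | ls≡ls' , rs≡rs'
    = cong₂ (node x) (levels-injective l l' ls≡ls') (levels-injective r r' rs≡rs')

  labelString-injective : {n : ℕ} (t u : PTree A n) → labelString t ≡ labelString u → t ≡ u
  labelString-injective t u eq =
    levels-injective t u (concat-cancel (levels-sameLengths t u) eq)

module Regularization {a ℓ : Level} {A : Set a} (_<_ : Rel A ℓ)
                      (sto : IsStrictTotalOrder _≡_ _<_) where

  open Regularize _<_ sto
  open IsStrictTotalOrder sto using (_≟_; _<?_)
  module Lex = IsStrictTotalOrder (<-isStrictTotalOrder sto)

  sortedNode : {n : ℕ} → A → PTree A n → PTree A n → PTree A (suc n)
  sortedNode x l r with <-decidable _≟_ _<?_ (labelString r) (labelString l)
  ... | yes _ = node x r l
  ... | no  _ = node x l r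

  fullLeftReg-node : {n : ℕ} (x : A) (l r : PTree A n) →
                     fullLeftReg (node x l r) ≡ sortedNode x (fullLeftReg l) (fullLeftReg r)
  fullLeftReg-node x l r
    with <-decidable _≟_ _<?_ (labelString (fullLeftReg r)) (labelString (fullLeftReg l))
  ... | yes _ = refl
  ... | no  _ = refl

  ≮ₗ∧≯ₗ⇒≡ : {xs ys : List A} → ¬ xs <ₗ ys → ¬ ys <ₗ xs → xs ≡ ys
  ≮ₗ∧≯ₗ⇒≡ {xs} {ys} xs≮ys ys≮xs with Lex.compare xs ys
  ... | tri< xs<ys _ _ = ⊥-elim (xs≮ys xs<ys)
  ... | tri≈ _ xs≈ys _ = Pointwise-≡⇒≡ xs≈ys
  ... | tri> _ _ ys<xs = ⊥-elim (ys≮xs ys<xs)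

  sortedNode-comm : {n : ℕ} (x : A) (l r : PTree A n) → sortedNode x l r ≡ sortedNode x r l
  sortedNode-comm x l r with <-decidable _≟_ _<?_ (labelString r) (labelString l)
                           | <-decidable _≟_ _<?_ (labelString l) (labelString r)
  ... | yes r<l | yes l<r = ⊥-elim (Lex.asym r<l l<r)
  ... | yes _   | no  _   = refl
  ... | no  _   | yes _   = refl
  ... | no  r≮l | no  l≮r with labelString-injective l r (≮ₗ∧≯ₗ⇒≡ l≮r r≮l)
  ...   | refl = refl

  node∼sortedNode : {n : ℕ} (x : A) (l r : PTree A n) → node x l r ∼ sortedNode x l r
  node∼sortedNode x l r with <-decidable _≟_ _<?_ (labelString r) (labelString l)
  ... | yes _ = swap x (∼-refl l) (∼-refl r)
  ... | no  _ = ∼-refl _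

  ∼-fullLeftReg : {n : ℕ} (t : PTree A n) → t ∼ fullLeftReg t
  ∼-fullLeftReg (leaf x) = leaf∼ x
  ∼-fullLeftReg (node x l r) rewrite fullLeftReg-node x l r =
    ∼-trans (keep x (∼-fullLeftReg l) (∼-fullLeftReg r))
            (node∼sortedNode x (fullLeftReg l) (fullLeftReg r))

  fullLeftReg-resp-∼ : {n : ℕ} {t u : PTree A n} → t ∼ u → fullLeftReg t ≡ fullLeftReg u
  fullLeftReg-resp-∼ (leaf∼ x) = refl
  fullLeftReg-resp-∼ (keep x {l} {l'} {r} {r'} l∼l' r∼r')
    rewrite fullLeftReg-node x l r | fullLeftReg-node x l' r'
          | fullLeftReg-resp-∼ l∼l' | fullLeftReg-resp-∼ r∼r' = refl
  fullLeftReg-resp-∼ (swap x {l} {l'} {r} {r'} l∼l' r∼r')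
    rewrite fullLeftReg-node x l r | fullLeftReg-node x r' l'
          | fullLeftReg-resp-∼ l∼l' | fullLeftReg-resp-∼ r∼r' =
    sortedNode-comm x (fullLeftReg l') (fullLeftReg r')

  module FullLeftRegCanonical {n : ℕ} =
    CanonicalForm (∼-isEquivalence {n = n}) fullLeftReg ∼-fullLeftReg fullLeftReg-resp-∼
  open FullLeftRegCanonical public

mainTheorem5 : {a ℓ : Level} {A : Set a} (_<_ : Rel A ℓ)
    (sto : IsStrictTotalOrder _≡_ _<_) (n : ℕ) →
    ((T T' : PTree A n) →
      ((T ∼ T' → Regularize.fullLeftReg _<_ sto T ≡ Regularize.fullLeftReg _<_ sto T')
      × (Regularize.fullLeftReg _<_ sto T ≡ Regularize.fullLeftReg _<_ sto T' → T ∼ T')))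
    × ((T : PTree A n) →
      Σ (PTree A n) (λ R → (T ∼ R) × (Regularize.fullLeftReg _<_ sto R ≡ R)
        × ((R' : PTree A n) → T ∼ R' → Regularize.fullLeftReg _<_ sto R' ≡ R' → R' ≡ R)))
mainTheorem5 _<_ sto n =
  (λ _ _ → fullLeftReg-resp-∼ , ≡-reflects-≈) ,
  (λ T → fullLeftReg T , ∼-fullLeftReg T , f-idem T ,
         λ _ → fixedPoint-unique)
  where
  open Regularize _<_ sto
  open Regularization _<_ sto
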